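{- Let $s\ge 3$. In the Maker-Breaker game played on the edges of the complete graph $K_s$, Maker can ensure that his claimed edges contain a path with $s-2$ edges (i.e. a path through all but one vertex of $K_s$).
   Context: In the Maker-Breaker game on a graph $G$, Breaker and Maker alternately claim unclaimed edges of $G$, Breaker moving first, until all edges are claimed. -}

module Defs where

open import Data.Nat using (ℕ; suc; _∸_)
open import Data.Fin using (Fin; toℕ; inject₁) renaming (suc to fsuc)
open import Data.Fin using () renaming (_<_ to _<ᶠ_)
open import Data.Product using (Σ; _×_; _,_; ∃)
open import Data.Sum using (_⊎_)
open import Data.List using (List; _∷_; [])
open import Data.List.Membership.Propositional using (_∈_; _∉_)
open import Relation.Binary.PropositionalEquality using (_≡_)
open import Relation.Nullary using (¬_)
open import Function.Definitions using (Injective)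

-- An edge of the complete graph K_s on vertex set Fin s:
-- an unordered pair {i , j}, represented with i < j.
Edge : ℕ → Set
Edge s = Σ (Fin s × Fin s) λ { (i , j) → i <ᶠ j }

Joins : ∀ {s} → Edge s → Fin s → Fin s → Set
Joins ((i , j) , _) x y = (x ≡ i × y ≡ j) ⊎ (x ≡ j × y ≡ i)

Adj : ∀ {s} → List (Edge s) → Fin s → Fin s → Set
Adj M x y = ∃ λ e → e ∈ M × Joins e x y

HasPath : ∀ {s} → ℕ → List (Edge s) → Set
HasPath {s} k M =
  Σ (Fin (suc k) → Fin s) λ v →
    Injective _≡_ _≡_ v × (∀ (i : Fin k) → Adj M (v (inject₁ i)) (v (fsuc i)))

-- Position: M = Maker's claimed edges, B = Breaker's claimed edges.
Unclaimed : ∀ {s} → List (Edge s) → List (Edge s) → Edge s → Set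
Unclaimed M B e = e ∉ M × e ∉ B

AllClaimed : ∀ {s} → List (Edge s) → List (Edge s) → Set
AllClaimed M B = ∀ e → e ∈ M ⊎ e ∈ B

-- MakerWinsB: Breaker to move; MakerWinsM: Maker to move.
mutual
  data MakerWinsB {s} (Goal : List (Edge s) → Set) (M B : List (Edge s)) : Set where
    done : AllClaimed M B → Goal M → MakerWinsB Goal M B
    bmove : ¬ AllClaimed M B →
            (∀ e → Unclaimed M B e → MakerWinsM Goal M (e ∷ B)) →
            MakerWinsB Goal M B

  data MakerWinsM {s} (Goal : List (Edge s) → Set) (M B : List (Edge s)) : Set where
    done : AllClaimed M B → Goal M → MakerWinsM Goal M B
    mmove : (e : Edge s) → Unclaimed M B e →
            MakerWinsB Goal (e ∷ M) B → MakerWinsM Goal M B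

MakerWinsPathGame : (s k : ℕ) → Set
MakerWinsPathGame s k = MakerWinsB {s} (HasPath k) [] []

-- Maker keeps a path v₀ … v_m in his graph, extending it by one vertex per
-- move, while all his edges join path vertices.  Call a vertex live if it is
-- off the path or an endpoint of it.  The invariant after each of Maker's
-- moves is that Breaker's edges from off-path vertices to live vertices
-- consist of at most one edge, and it is incident to v₀.  Breaker's next edge
-- f creates at most one further such edge; Maker then extends the path at v₀
-- (so the old threat stops mattering) by a vertex chosen according to how f
-- meets the path, and either f becomes the unique threat at the new first
-- vertex, or at the last vertex (then the path is read backwards), or it
-- threatens nothing.  Extending needs two off-path vertices, and three when f
-- is incident to v₀; in the very last round only an unclaimed extension edge
-- is needed, which two off-path vertices guarantee.  This reaches s − 1
-- vertices, and the remaining moves are irrelevant.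

module Submission where

open import Defs
open import Data.Nat using (ℕ; zero; suc; _+_; _≤_; _<_; _∸_; z≤n; s≤s; z<s)
open import Data.Nat.Properties using (+-suc; +-comm; m<n+m; n<1+n; <⇒≤; <⇒≱; <-irrelevant; ≤-refl; <-≤-trans)
open import Data.Fin using (Fin; fromℕ; inject₁; opposite; _<?_) renaming (zero to fzero; suc to fsuc)
open import Data.Fin.Properties using (_≟_; <-cmp; <-irrefl; opposite-involutive; ¬∀⟶∃¬; injective⇒≤; any?; all?)
open import Data.Vec.Functional using (Vector; head; last; reverse) renaming (_∷_ to _◂_)
open import Data.Product using (Σ; ∃; _×_; _,_; proj₁; proj₂)
open import Data.Sum using (_⊎_; inj₁; inj₂)
open import Data.Empty using (⊥-elim)
open import Data.List using (List; []; _∷_; length; filter; concatMap; cartesianProduct; allFin)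
open import Data.List.Properties using (filter-notAll)
open import Data.List.Relation.Unary.Any as Any using (here; there; satisfied)
open import Data.List.Membership.Propositional using (_∈_; lose)
open import Data.List.Membership.Propositional.Properties using (∈-allFin; ∈-concatMap⁺; ∈-cartesianProduct⁺; ∈-filter⁺)
open import Function using (_∘_)
open import Function.Definitions using (Injective)
open import Relation.Binary.Definitions using (DecidableEquality; tri<; tri≈; tri>)
open import Relation.Binary.PropositionalEquality using (_≡_; _≢_; refl; sym; trans; cong; subst; ≢-sym)
open import Relation.Nullary using (¬_; Dec; yes; no)
open import Relation.Nullary.Decidable using (¬?; _×-dec_; decidable-stable)

module _ {s : ℕ} where

  _≟ᴱ_ : DecidableEquality (Edge s)
  ((i , j) , i<j) ≟ᴱ ((i′ , j′) , i′<j′) with i ≟ i′ | j ≟ j′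
  ... | yes refl | yes refl = yes (cong ((i , j) ,_) (<-irrelevant i<j i′<j′))
  ... | no i≢i′  | _        = no (i≢i′ ∘ cong (proj₁ ∘ proj₁))
  ... | yes _    | no j≢j′  = no (j≢j′ ∘ cong (proj₂ ∘ proj₁))

  open import Data.List.Membership.DecPropositional _≟ᴱ_ using (_∈?_)

  edgeOn : Fin s × Fin s → List (Edge s)
  edgeOn (i , j) with i <? j
  ... | yes i<j = ((i , j) , i<j) ∷ []
  ... | no _    = []

  allEdges : List (Edge s)
  allEdges = concatMap edgeOn (cartesianProduct (allFin s) (allFin s))

  ∈-allEdges : ∀ e → e ∈ allEdges
  ∈-allEdges e@((i , j) , i<j) =
    ∈-concatMap⁺ edgeOn (lose (∈-cartesianProduct⁺ (∈-allFin i) (∈-allFin j)) ∈-edgeOn)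
    where
    ∈-edgeOn : e ∈ edgeOn (i , j)
    ∈-edgeOn with i <? j
    ... | yes i<j′ = here (cong ((i , j) ,_) (<-irrelevant i<j i<j′))
    ... | no i≮j   = ⊥-elim (i≮j i<j)

  joiningEdge : ∀ {x y} → x ≢ y → Σ (Edge s) λ e → Joins e x y
  joiningEdge {x} {y} x≢y with <-cmp x y
  ... | tri< x<y _ _ = ((x , y) , x<y) , inj₁ (refl , refl)
  ... | tri≈ _ x≡y _ = ⊥-elim (x≢y x≡y)
  ... | tri> _ _ y<x = ((y , x) , y<x) , inj₂ (refl , refl)

  joins-sym : ∀ e {x y} → Joins {s} e x y → Joins e y x
  joins-sym _ (inj₁ (x≡i , y≡j)) = inj₂ (y≡j , x≡i)
  joins-sym _ (inj₂ (x≡j , y≡i)) = inj₁ (y≡i , x≡j)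

  joins-irrefl : ∀ e {x y} → Joins {s} e x y → x ≢ y
  joins-irrefl (_ , i<j) (inj₁ (refl , refl)) i≡j = <-irrefl i≡j i<j
  joins-irrefl (_ , i<j) (inj₂ (refl , refl)) j≡i = <-irrefl (sym j≡i) i<j

  joins-other : ∀ e {x y c d} → Joins {s} e x y → Joins e c d → x ≢ c → x ≡ d × y ≡ c
  joins-other _ (inj₁ (refl , refl)) (inj₁ (refl , refl)) x≢c = ⊥-elim (x≢c refl)
  joins-other _ (inj₁ (refl , refl)) (inj₂ (refl , refl)) _   = refl , refl
  joins-other _ (inj₂ (refl , refl)) (inj₁ (refl , refl)) _   = refl , refl
  joins-other _ (inj₂ (refl , refl)) (inj₂ (refl , refl)) x≢c = ⊥-elim (x≢c refl)

  joins-ends : ∀ e {x y c d} → Joins {s} e x y → Joins e c d → x ≡ c ⊎ x ≡ d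
  joins-ends e {x} {c = c} jxy jcd with x ≟ c
  ... | yes x≡c = inj₁ x≡c
  ... | no x≢c  = inj₂ (proj₁ (joins-other e jxy jcd x≢c))

  Incident : Edge s → Fin s → Set
  Incident e c = ∃ (Joins e c)

  incident? : ∀ e c → Dec (Incident e c)
  incident? ((i , j) , _) c with c ≟ i | c ≟ j
  ... | yes c≡i | _       = yes (j , inj₁ (c≡i , refl))
  ... | no _    | yes c≡j = yes (i , inj₂ (c≡j , refl))
  ... | no c≢i  | no c≢j  = no λ { (_ , inj₁ (c≡i , _)) → c≢i c≡i
                                 ; (_ , inj₂ (c≡j , _)) → c≢j c≡j }

  Adj-sym : ∀ {M : List (Edge s)} {x y} → Adj M x y → Adj M y x
  Adj-sym (e , e∈M , j) = e , e∈M , joins-sym e j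

  Adj-∷⁺ : ∀ {M : List (Edge s)} {e x y} → Adj M x y → Adj (e ∷ M) x y
  Adj-∷⁺ (e , e∈M , j) = e , there e∈M , j

  Adj-∷⁻ : ∀ {M : List (Edge s)} {f x y} → Adj (f ∷ M) x y → Joins f x y ⊎ Adj M x y
  Adj-∷⁻ (_ , here refl , j)  = inj₁ j
  Adj-∷⁻ (e , there e∈M , j) = inj₂ (e , e∈M , j)

  ¬Adj-∷ : ∀ {M : List (Edge s)} {f x y} → ¬ Joins f x y → ¬ Adj M x y → ¬ Adj (f ∷ M) x y
  ¬Adj-∷ ¬j ¬adj adj with Adj-∷⁻ adj
  ... | inj₁ j    = ¬j j
  ... | inj₂ adj′ = ¬adj adj′

  hasPath-∷ : ∀ {n M e} → HasPath {s} n M → HasPath n (e ∷ M)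
  hasPath-∷ (v , inj , adj) = v , inj , Adj-∷⁺ ∘ adj

  unclaimed? : ∀ M B e → Dec (Unclaimed {s} M B e)
  unclaimed? M B e = ¬? (e ∈? M) ×-dec ¬? (e ∈? B)

  unclaimed⇒¬allClaimed : ∀ {M B e} → Unclaimed {s} M B e → ¬ AllClaimed M B
  unclaimed⇒¬allClaimed {e = e} (e∉M , e∉B) full with full e
  ... | inj₁ e∈M = e∉M e∈M
  ... | inj₂ e∈B = e∉B e∈B

  unclaimed-∷ˡ : ∀ {M B e e′} → Unclaimed {s} (e ∷ M) B e′ → Unclaimed M B e′ × e ≢ e′
  unclaimed-∷ˡ (e′∉eM , e′∉B) = (e′∉eM ∘ there , e′∉B) , λ { refl → e′∉eM (here refl) }

  unclaimed-∷ʳ : ∀ {M B e e′} → Unclaimed {s} M (e ∷ B) e′ → Unclaimed M B e′ × e ≢ e′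
  unclaimed-∷ʳ (e′∉M , e′∉eB) = (e′∉M , e′∉eB ∘ there) , λ { refl → e′∉eB (here refl) }

  Covers : List (Edge s) → List (Edge s) → List (Edge s) → Set
  Covers M B U = ∀ e → Unclaimed M B e → e ∈ U

  without : Edge s → List (Edge s) → List (Edge s)
  without e = filter (λ e′ → ¬? (e ≟ᴱ e′))

  length-without : ∀ {e U} → e ∈ U → length (without e U) < length U
  length-without e∈U = filter-notAll _ _ (lose e∈U (λ e≢e → e≢e refl))

  covers-claim : ∀ {M B M′ B′ U} e →
                 (∀ {e′} → Unclaimed M′ B′ e′ → Unclaimed M B e′ × e ≢ e′) →
                 Covers M B U → Covers M′ B′ (without e U)
  covers-claim _ shrink cov e′ free′ with shrink free′
  ... | free , e≢e′ = ∈-filter⁺ _ (cov e′ free) e≢e′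

  allClaimed-or-free : ∀ {M B U} → Covers M B U → AllClaimed M B ⊎ ∃ (Unclaimed M B)
  allClaimed-or-free {M} {B} {U} cov with Any.any? (unclaimed? M B) U
  ... | yes some = inj₂ (satisfied some)
  ... | no none  = inj₁ claimed
    where
    claimed : AllClaimed M B
    claimed e with e ∈? M | e ∈? B
    ... | yes e∈M | _       = inj₁ e∈M
    ... | no _    | yes e∈B = inj₂ e∈B
    ... | no e∉M  | no e∉B  = ⊥-elim (none (lose (cov e (e∉M , e∉B)) (e∉M , e∉B)))

  module _ {Goal : List (Edge s) → Set} (Goal-∷ : ∀ {e M} → Goal M → Goal (e ∷ M)) where

    -- The length of a list covering the unclaimed edges bounds the rest of the game.
    mutual
      goal⇒makerWinsB′ : ∀ {n M B U} → length U ≤ n → Covers M B U → Goal M → MakerWinsB Goal M B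
      goal⇒makerWinsB′ bound cov goal with allClaimed-or-free cov
      ... | inj₁ full          = done full goal
      ... | inj₂ (_ , free)    = bmove (unclaimed⇒¬allClaimed free) λ e free′ →
        goal⇒makerWinsM′ (<-≤-trans (length-without (cov e free′)) bound)
                         (covers-claim e unclaimed-∷ʳ cov) goal

      goal⇒makerWinsM′ : ∀ {n M B U} → length U < n → Covers M B U → Goal M → MakerWinsM Goal M B
      goal⇒makerWinsM′ (s≤s bound) cov goal with allClaimed-or-free cov
      ... | inj₁ full       = done full goal
      ... | inj₂ (e , free) = mmove e free
        (goal⇒makerWinsB′ (<⇒≤ (<-≤-trans (length-without (cov e free)) bound))
                          (covers-claim e unclaimed-∷ˡ cov) (Goal-∷ goal))

    goal⇒makerWinsB : ∀ {M B} → Goal M → MakerWinsB Goal M B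
    goal⇒makerWinsB = goal⇒makerWinsB′ ≤-refl (λ e _ → ∈-allEdges e)

  Outside : ∀ {m} → Vector (Fin s) m → Fin s → Set
  Outside v x = ∀ i → v i ≢ x

  outside? : ∀ {m} (v : Vector (Fin s) m) x → Dec (Outside v x)
  outside? v x = all? λ i → ¬? (v i ≟ x)

  outsideVertex : ∀ {m} (v : Vector (Fin s) m) → m < s → ∃ (Outside v)
  outsideVertex {m} v m<s with any? (outside? v)
  ... | yes found = found
  ... | no none   = ⊥-elim (<⇒≱ m<s (injective⇒≤ preimage-injective))
    where
    preimage : ∀ x → ∃ λ i → v i ≡ x
    preimage x with ¬∀⟶∃¬ m _ (λ i → ¬? (v i ≟ x)) (λ x∉v → none (x , x∉v))
    ... | i , ¬vi≢x = i , decidable-stable (v i ≟ x) ¬vi≢x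
    preimage-injective : Injective _≡_ _≡_ (proj₁ ∘ preimage)
    preimage-injective {x} {y} i≡j =
      trans (sym (proj₂ (preimage x))) (trans (cong v i≡j) (proj₂ (preimage y)))

  outside-reverse⁺ : ∀ {m} {v : Vector (Fin s) m} {x} → Outside v x → Outside (reverse v) x
  outside-reverse⁺ x∉v = x∉v ∘ opposite

  outside-reverse⁻ : ∀ {m} {v : Vector (Fin s) m} {x} → Outside (reverse v) x → Outside v x
  outside-reverse⁻ {v = v} x∉v i = subst (_≢ _) (cong v (opposite-involutive i)) (x∉v (opposite i))

  Live : ∀ {n} → Vector (Fin s) (suc n) → Fin s → Set
  Live v y = Outside v y ⊎ y ≡ head v ⊎ y ≡ last v

  opposite-inject₁ : ∀ {n} (i : Fin n) → opposite (inject₁ i) ≡ fsuc (opposite i)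
  opposite-inject₁ {suc n} fzero    = refl
  opposite-inject₁ {suc n} (fsuc i) = cong inject₁ (opposite-inject₁ i)

  opposite-fromℕ : ∀ n → opposite (fromℕ n) ≡ fzero
  opposite-fromℕ zero    = refl
  opposite-fromℕ (suc n) = cong inject₁ (opposite-fromℕ n)

  live-reverse : ∀ {n} {v : Vector (Fin s) (suc n)} {y} → Live (reverse v) y → Live v y
  live-reverse (inj₁ y∉v)       = inj₁ (outside-reverse⁻ y∉v)
  live-reverse (inj₂ (inj₁ eq)) = inj₂ (inj₂ eq)
  live-reverse {n} {v} (inj₂ (inj₂ eq)) = inj₂ (inj₁ (trans eq (cong v (opposite-fromℕ n))))

  record MakerPath (n : ℕ) (M : List (Edge s)) : Set where
    field
      vertex    : Vector (Fin s) (suc n)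
      injective : Injective _≡_ _≡_ vertex
      adjacent  : ∀ i → Adj M (vertex (inject₁ i)) (vertex (fsuc i))
      onPath    : ∀ {e x y} → e ∈ M → Joins e x y → ¬ Outside vertex x

  open MakerPath

  hasPath : ∀ {n M} → MakerPath n M → HasPath n M
  hasPath P = vertex P , injective P , adjacent P

  singleVertex : Fin s → MakerPath 0 []
  singleVertex c = record
    { vertex = λ _ → c ; injective = λ { {fzero} {fzero} _ → refl } ; adjacent = λ () ; onPath = λ () }

  head≢last : ∀ {k M} (P : MakerPath (suc k) M) → head (vertex P) ≢ last (vertex P)
  head≢last P eq with injective P eq
  ... | ()

  reversePath : ∀ {n M} → MakerPath n M → MakerPath n M
  reversePath {n} {M} P = record
    { vertex    = reverse v
    ; injective = λ {i} {j} eq → trans (sym (opposite-involutive i))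
                                  (trans (cong opposite (injective P eq)) (opposite-involutive j))
    ; adjacent  = adjacent′
    ; onPath    = λ e∈M j → onPath P e∈M j ∘ outside-reverse⁻
    }
    where
    v = vertex P
    adjacent′ : ∀ i → Adj M (v (opposite (inject₁ i))) (v (inject₁ (opposite i)))
    adjacent′ i = subst (λ j → Adj M (v j) (v (inject₁ (opposite i))))
                        (sym (opposite-inject₁ i)) (Adj-sym (adjacent P (opposite i)))

  module Extension {n M} (P : MakerPath n M) {w} (w∉P : Outside (vertex P) w) where

    edge : Edge s
    edge = proj₁ (joiningEdge (w∉P fzero))

    joins : Joins edge (head (vertex P)) w
    joins = proj₂ (joiningEdge (w∉P fzero))

    extended : MakerPath (suc n) (edge ∷ M)
    extended = record { vertex = w ◂ vertex P ; injective = injective′ ; adjacent = adjacent′ ; onPath = onPath′ }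
      where
      injective′ : Injective _≡_ _≡_ (w ◂ vertex P)
      injective′ {fzero}  {fzero}  _  = refl
      injective′ {fzero}  {fsuc j} eq = ⊥-elim (w∉P j (sym eq))
      injective′ {fsuc i} {fzero}  eq = ⊥-elim (w∉P i eq)
      injective′ {fsuc i} {fsuc j} eq = cong fsuc (injective P eq)
      adjacent′ : ∀ i → Adj (edge ∷ M) ((w ◂ vertex P) (inject₁ i)) ((w ◂ vertex P) (fsuc i))
      adjacent′ fzero    = edge , here refl , joins-sym edge joins
      adjacent′ (fsuc i) = Adj-∷⁺ (adjacent P i)
      onPath′ : ∀ {e x y} → e ∈ edge ∷ M → Joins e x y → ¬ Outside (w ◂ vertex P) x
      onPath′ (here refl) j x∉P′ with joins-ends edge j joins
      ... | inj₁ x≡head = x∉P′ (fsuc fzero) (sym x≡head)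
      ... | inj₂ x≡w    = x∉P′ fzero (sym x≡w)
      onPath′ (there e∈M) j x∉P′ = onPath P e∈M j (x∉P′ ∘ fsuc)

    unclaimed : ∀ {B} → ¬ Adj B (head (vertex P)) w → Unclaimed M B edge
    unclaimed ¬adj = (λ e∈M → onPath P e∈M (joins-sym edge joins) w∉P) ,
                     (λ e∈B → ¬adj (edge , e∈B , joins))

  live-extend : ∀ {k M w y} (P : MakerPath (suc k) M) → Outside (vertex P) w →
                Live (w ◂ vertex P) y → Live (vertex P) y × y ≢ head (vertex P)
  live-extend P w∉P (inj₁ y∉)         = inj₁ (y∉ ∘ fsuc) , ≢-sym (y∉ (fsuc fzero))
  live-extend P w∉P (inj₂ (inj₁ refl)) = inj₁ w∉P , ≢-sym (w∉P fzero)
  live-extend P w∉P (inj₂ (inj₂ refl)) = inj₂ (inj₂ refl) , ≢-sym (head≢last P)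

  -- blocked is junk when no Breaker edge joins an outside vertex to a live one.
  record Position (k : ℕ) (M B : List (Edge s)) : Set where
    field
      path        : MakerPath (suc k) M
      blocked     : Fin s
      breakerSafe : ∀ {x y} → Outside (vertex path) x → Live (vertex path) y → Adj B x y →
                    x ≡ blocked × y ≡ head (vertex path)

  Response : ℕ → List (Edge s) → List (Edge s) → Set
  Response k M B = Σ (Edge s) λ e → Unclaimed M B e × Position (suc k) (e ∷ M) B

  FinalResponse : ℕ → List (Edge s) → List (Edge s) → Set
  FinalResponse k M B = Σ (Edge s) λ e → Unclaimed M B e × MakerPath (suc (suc k)) (e ∷ M)

  module PositionProperties {k M B} (S : Position k M B) where
    open Position S

    v : Vector (Fin s) (suc (suc k))
    v = vertex path

    unblocked : ∀ {w} → Outside v w → blocked ≢ w → ¬ Adj B (head v) w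
    unblocked w∉v blocked≢w adj = blocked≢w (sym (proj₁ (breakerSafe w∉v (inj₂ (inj₁ refl)) (Adj-sym adj))))

    ¬allClaimed : suc (suc (suc k)) < s → ¬ AllClaimed M B
    ¬allClaimed bound with outsideVertex (blocked ◂ v) bound
    ... | w , w∉ =
      unclaimed⇒¬allClaimed (Extension.unclaimed path (w∉ ∘ fsuc) (unblocked (w∉ ∘ fsuc) (w∉ fzero)))

    -- Extending at the head makes it interior, which disarms the only threat.
    oldEdgesHarmless : ∀ {w} (w∉v : Outside v w) {x y} →
                       Outside (w ◂ v) x → Live (w ◂ v) y → ¬ Adj B x y
    oldEdgesHarmless w∉v x∉ y-live adj with live-extend path w∉v y-live
    ... | y-live′ , y≢a = y≢a (proj₂ (breakerSafe (x∉ ∘ fsuc) y-live′ adj))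

  module Respond {k M B} (S : Position k M B) (f : Edge s) where
    open Position S
    open PositionProperties S

    a b : Fin s
    a = head v
    b = last v

    extendWith : ∀ {w} (w∉v : Outside v w) → ¬ Joins f a w → blocked ≢ w → (z : Fin s) →
                 (∀ {x y} → Outside (w ◂ v) x → Live (w ◂ v) y → Joins f x y → x ≡ z × y ≡ w) →
                 Response k M (f ∷ B)
    extendWith {w} w∉v f∤aw blocked≢w z fSafe =
      edge , unclaimed (¬Adj-∷ f∤aw (unblocked w∉v blocked≢w)) ,
      record { path = extended ; blocked = z ; breakerSafe = safe }
      where
      open Extension path w∉v
      safe : ∀ {x y} → Outside (w ◂ v) x → Live (w ◂ v) y → Adj (f ∷ B) x y → x ≡ z × y ≡ w
      safe x∉ y-live adj with Adj-∷⁻ adj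
      ... | inj₁ j    = fSafe x∉ y-live j
      ... | inj₂ adj′ = ⊥-elim (oldEdgesHarmless w∉v x∉ y-live adj′)

    extendReversedWith : ∀ {w} (w∉v : Outside v w) → ¬ Joins f a w → blocked ≢ w → (z : Fin s) →
                         (∀ {x y} → Outside (w ◂ v) x → Joins f x y → x ≡ z × y ≡ b) →
                         Response k M (f ∷ B)
    extendReversedWith {w} w∉v f∤aw blocked≢w z fSafe =
      edge , unclaimed (¬Adj-∷ f∤aw (unblocked w∉v blocked≢w)) ,
      record { path = reversePath extended ; blocked = z ; breakerSafe = safe }
      where
      open Extension path w∉v
      safe : ∀ {x y} → Outside (reverse (w ◂ v)) x → Live (reverse (w ◂ v)) y → Adj (f ∷ B) x y →
             x ≡ z × y ≡ b
      safe x∉ y-live adj with Adj-∷⁻ adj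
      ... | inj₁ j    = fSafe (outside-reverse⁻ x∉) j
      ... | inj₂ adj′ = ⊥-elim (oldEdgesHarmless w∉v (outside-reverse⁻ x∉) (live-reverse y-live) adj′)

    respondAtHead : ∀ {t} → Joins f a t → suc (suc (suc (suc k))) < s → Response k M (f ∷ B)
    respondAtHead {t} jat bound with outsideVertex (t ◂ blocked ◂ v) bound
    ... | w , w∉ = extendWith (w∉ ∘ fsuc ∘ fsuc) f∤aw (w∉ (fsuc fzero)) w noThreat
      where
      f∤aw : ¬ Joins f a w
      f∤aw jaw = w∉ fzero (sym (proj₁ (joins-other f (joins-sym f jaw) jat (≢-sym (w∉ (fsuc (fsuc fzero)))))))
      noThreat : ∀ {x y} → Outside (w ◂ v) x → Live (w ◂ v) y → Joins f x y → x ≡ w × y ≡ w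
      noThreat x∉ y-live j = ⊥-elim (proj₂ (live-extend path (w∉ ∘ fsuc ∘ fsuc) y-live)
                                       (proj₂ (joins-other f j jat (≢-sym (x∉ (fsuc fzero))))))

    respondAtLast : ∀ {z} → ¬ Incident f a → Joins f b z → suc (suc (suc k)) < s → Response k M (f ∷ B)
    respondAtLast {z} f∤a jbz bound with outsideVertex (blocked ◂ v) bound
    ... | w , w∉ = extendReversedWith (w∉ ∘ fsuc) (f∤a ∘ (w ,_)) (w∉ fzero) z
      λ x∉ j → joins-other f j jbz (≢-sym (x∉ (fromℕ (suc (suc k)))))

    respondAtFreeEnd : ∀ {w z} → ¬ Incident f a → Joins f w z → Outside v w → blocked ≢ w →
                       Response k M (f ∷ B)
    respondAtFreeEnd {w} {z} f∤a jwz w∉v blocked≢w = extendWith w∉v (f∤a ∘ (w ,_)) blocked≢w z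
      λ x∉ _ j → joins-other f j jwz (≢-sym (x∉ fzero))

    respondElsewhere : ¬ Incident f a → ¬ Incident f b →
                       (∀ {c} → Incident f c → Outside v c → c ≡ blocked) →
                       suc (suc (suc k)) < s → Response k M (f ∷ B)
    respondElsewhere f∤a f∤b freeEndsBlocked bound with outsideVertex (blocked ◂ v) bound
    ... | w , w∉ = extendWith (w∉ ∘ fsuc) (f∤a ∘ (w ,_)) (w∉ fzero) w noThreat
      where
      noThreat : ∀ {x y} → Outside (w ◂ v) x → Live (w ◂ v) y → Joins f x y → x ≡ w × y ≡ w
      noThreat {x} {y} x∉ y-live j with freeEndsBlocked (y , j) (x∉ ∘ fsuc) | y-live
      ... | x≡blocked | inj₁ y∉ =
        ⊥-elim (joins-irrefl f j (trans x≡blocked (sym (freeEndsBlocked (x , joins-sym f j) (y∉ ∘ fsuc)))))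
      ... | _ | inj₂ (inj₁ refl) = ⊥-elim (w∉ fzero (sym (freeEndsBlocked (x , joins-sym f j) (w∉ ∘ fsuc))))
      ... | _ | inj₂ (inj₂ refl) = ⊥-elim (f∤b (x , joins-sym f j))

    respond : suc (suc (suc (suc k))) < s → Response k M (f ∷ B)
    respond bound with incident? f a
    ... | yes (_ , jat) = respondAtHead jat bound
    ... | no f∤a with incident? f b
    ... | yes (_ , jbz) = respondAtLast f∤a jbz (<⇒≤ bound)
    ... | no f∤b with any? (λ c → incident? f c ×-dec outside? v c ×-dec ¬? (blocked ≟ c))
    ... | yes (_ , (_ , jwz) , w∉v , blocked≢w) = respondAtFreeEnd f∤a jwz w∉v blocked≢w
    ... | no none = respondElsewhere f∤a f∤b
      (λ {c} inc c∉v → decidable-stable (c ≟ blocked) λ c≢blocked → none (c , inc , c∉v , ≢-sym c≢blocked))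
      (<⇒≤ bound)

    finalMove : suc (suc (suc k)) < s → FinalResponse k M (f ∷ B)
    finalMove bound with incident? f b
    ... | yes (z , jbz) with outsideVertex (blocked ◂ v) bound
    ...   | w , w∉ = Extension.edge path (w∉ ∘ fsuc) ,
                     Extension.unclaimed path (w∉ ∘ fsuc) (¬Adj-∷ f∤aw (unblocked (w∉ ∘ fsuc) (w∉ fzero))) ,
                     Extension.extended path (w∉ ∘ fsuc)
      where
      f∤aw : ¬ Joins f a w
      f∤aw jaw = w∉ (fsuc (fromℕ (suc k))) (sym (proj₂ (joins-other f jaw jbz (head≢last path))))
    finalMove bound | no f∤b with outsideVertex v (<⇒≤ bound)
    ... | w , w∉v = Extension.edge reversed w∉ ,
                    Extension.unclaimed reversed w∉ (¬Adj-∷ (f∤b ∘ (w ,_)) unblocked′) ,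
                    Extension.extended reversed w∉
      where
      reversed = reversePath path
      w∉ = outside-reverse⁺ w∉v
      unblocked′ : ¬ Adj B b w
      unblocked′ adj = head≢last path (sym (proj₂ (breakerSafe w∉v (inj₂ (inj₂ refl)) (Adj-sym adj))))

  opening : 2 < s → (f : Edge s) → Σ (Edge s) λ e → Unclaimed [] (f ∷ []) e × Position 0 (e ∷ []) (f ∷ [])
  opening bound f@((p , q) , _) with outsideVertex (q ◂ vertex (singleVertex p)) bound
  ... | c , c∉ = edge , unclaimed ¬adj , record { path = reversePath extended ; blocked = q ; breakerSafe = safe }
    where
    open Extension (singleVertex p) (c∉ ∘ fsuc)
    ¬adj : ¬ Adj (f ∷ []) p c
    ¬adj (_ , here refl , jpc) =
      c∉ fzero (sym (proj₁ (joins-other f (joins-sym f jpc) (inj₁ (refl , refl)) (≢-sym (c∉ (fsuc fzero))))))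
    ¬adj (_ , there () , _)
    safe : ∀ {x y} → Outside (vertex (reversePath extended)) x → Live (vertex (reversePath extended)) y →
           Adj (f ∷ []) x y → x ≡ q × y ≡ p
    safe x∉ _ (_ , here refl , j) = joins-other f j (inj₁ (refl , refl)) (≢-sym (x∉ fzero))
    safe _ _ (_ , there () , _)

  goalReached : ∀ {n M} → n ≡ s ∸ 2 → MakerPath n M → HasPath (s ∸ 2) M
  goalReached refl P = hasPath P

  -- u + 1 vertices lie off the path when Breaker is to move.
  mutual
    breakerTurn : ∀ u {k M B} → suc u + suc (suc k) ≡ s → Position k M B → MakerWinsB (HasPath (s ∸ 2)) M B
    breakerTurn zero eq S =
      goal⇒makerWinsB hasPath-∷ (goalReached (cong (_∸ 2) eq) (Position.path S))
    breakerTurn (suc u) {k} eq S =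
      bmove (PositionProperties.¬allClaimed S (subst (suc (suc (suc k)) <_) eq (s≤s (m<n+m _ z<s)))) λ f _ →
        makerTurn u eq S f

    makerTurn : ∀ u {k M B} → suc (suc u) + suc (suc k) ≡ s → Position k M B →
                ∀ f → MakerWinsM (HasPath (s ∸ 2)) M (f ∷ B)
    makerTurn zero {k} eq S f =
      let e , free , P = Respond.finalMove S f (subst (suc (suc (suc k)) <_) eq (s≤s (n<1+n _)))
      in mmove e free (goal⇒makerWinsB hasPath-∷ (goalReached (cong (_∸ 2) eq) P))
    makerTurn (suc u) {k} eq S f =
      let e , free , S′ = Respond.respond S f (subst (suc (suc (suc (suc k))) <_) eq (s≤s (s≤s (m<n+m _ z<s))))
      in mmove e free (breakerTurn (suc u) (trans (+-suc (suc (suc u)) (suc (suc k))) eq) S′)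

lemma5p1 : (s : ℕ) → 3 ≤ s → MakerWinsPathGame s (s ∸ 2)
lemma5p1 (suc (suc (suc n))) 2<s@(s≤s (s≤s (s≤s _))) =
  bmove (unclaimed⇒¬allClaimed {e = (fzero , fsuc fzero) , s≤s z≤n} ((λ ()) , (λ ()))) λ f _ →
    let e , free , S = opening 2<s f
    in mmove e free (breakerTurn n (cong suc (+-comm n 2)) S)
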